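{- Let $\mathcal{P}$ (nonempty) and $\mathcal{N}$ be finite sets of trees with pairwise disjoint state sets, $S_\mathcal{P}=\bigcup_{P\in\mathcal{P}}S_P$. For every LPTS with $k$ states that is consistent with $\mathcal{P}$ and $\mathcal{N}$, there is a consistent partition of $S_\mathcal{P}$ of size at most $2^k$.
   Context: All probabilities are rationals. $\mathrm{Dist}(S)$: discrete distributions on $S$, $\mathrm{supp}(\mu)=\{s\mid\mu(s)>0\}$. An LPTS is $\langle S,s^0,\alpha,\tau\rangle$, finite $S$, start state $s^0$, finite actions $\alpha$, finite $\tau\subseteq S\times\alpha\times\mathrm{Dist}(S)$; $s\xrightarrow{a}\mu$ means $(s,a,\mu)\in\tau$. A tree is an LPTS whose start state (root) is in the support of no transition distribution and each other state is in the support of exactly one. $\mu_1\sqsubseteq_R\mu_2$ iff there is a weight function $w:S_1\times S_2\to\mathbb{Q}\cap[0,1]$ with row sums $\mu_1$, column sums $\mu_2$ and $w(s_1,s_2)>0\Rightarrow s_1Rs_2$; $R$ is a strong simulation iff $s_1Rs_2$, $s_1\xrightarrow{a}\mu_1$ imply some $s_2\xrightarrow{a}\mu_2$ with $\mu_1\sqsubseteq_R\mu_2$; $L_1\preceq L_2$ iff a strong simulation relates the start states. An LPTS $L$ is consistent with $\mathcal{P}$ and $\mathcal{N}$ iff $P\preceq L$ for all $P\in\mathcal{P}$ and $N\not\preceq L$ for all $N\in\mathcal{N}$. A partition $\Pi$ of $S_\mathcal{P}$ is always required to put all roots of trees in $\mathcal{P}$ into one class; $E_\Pi$ is its set of classes,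 $[s]_\Pi$ the class of $s$, and its size is $|E_\Pi|$. The quotient $\mathcal{P}/\Pi$ is the LPTS $\langle E_\Pi,e^0,\alpha,\tau\rangle$ where $e^0$ is the class of the roots, $\alpha=\bigcup_P\alpha_P$, and $(e,a,\mu)\in\tau$ iff there exist $P\in\mathcal{P}$ and $(s,a,\mu_p)\in\tau_P$ with $[s]_\Pi=e$ and $\mu(e')=\sum_{s'\in e'}\mu_p(s')$ for all $e'\in E_\Pi$. $\Pi$ is consistent iff $N\not\preceq\mathcal{P}/\Pi$ for every $N\in\mathcal{N}$. -}

module Defs where

open import Level using (0ℓ)
open import Data.Nat using (ℕ; zero; suc)
open import Data.Fin using (Fin; zero; suc; _≟_)
open import Data.Rational using (ℚ; 0ℚ; 1ℚ; _+_; _≤_; _<_)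
open import Data.List using (List; []; _∷_; length; lookup; map; concatMap; allFin)
open import Data.List.Membership.Propositional using (_∈_)
open import Data.List.Relation.Unary.All using (All)
open import Data.Product using (Σ; _×_; _,_; ∃)
open import Relation.Binary.PropositionalEquality using (_≡_; _≢_)
open import Relation.Nullary using (¬_; does)
open import Data.Bool using (if_then_else_)

sumF : ∀ {n} → (Fin n → ℚ) → ℚ
sumF {zero}  f = 0ℚ
sumF {suc n} f = f zero + sumF (λ i → f (suc i))

-- Actions are drawn from ℕ; the (finite) action set of an LPTS is the set of
-- actions occurring in its (finite) transition list.
Action : Set
Action = ℕ

record Trans (n : ℕ) : Set where
  constructor mkTrans
  field
    src  : Fin n
    act  : Action
    dist : Fin n → ℚ
open Trans public

record RawLTS : Set where
  constructor mkRaw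
  field
    size  : ℕ
    start : Fin size
    trans : List (Trans size)
open RawLTS public

IsDist : ∀ {n} → (Fin n → ℚ) → Set
IsDist μ = (∀ s → 0ℚ ≤ μ s) × sumF μ ≡ 1ℚ

IsLPTS : RawLTS → Set
IsLPTS L = All (λ t → IsDist (dist t)) (trans L)

InSupp : ∀ {n} → Fin n → (Fin n → ℚ) → Set
InSupp s μ = 0ℚ < μ s

IsTree : RawLTS → Set
IsTree L =
  (∀ (i : Fin (length (trans L))) → ¬ InSupp (start L) (dist (lookup (trans L) i)))
  × (∀ s → s ≢ start L →
       Σ (Fin (length (trans L))) λ i →
         InSupp s (dist (lookup (trans L) i))
         × (∀ j → InSupp s (dist (lookup (trans L) j)) → j ≡ i))

_⊑[_]_ : ∀ {n₁ n₂} → (Fin n₁ → ℚ) → (Fin n₁ → Fin n₂ → Set) → (Fin n₂ → ℚ) → Set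
_⊑[_]_ {n₁} {n₂} μ₁ R μ₂ =
  Σ (Fin n₁ → Fin n₂ → ℚ) λ w →
    (∀ i j → 0ℚ ≤ w i j × w i j ≤ 1ℚ)
    × (∀ i → sumF (λ j → w i j) ≡ μ₁ i)
    × (∀ j → sumF (λ i → w i j) ≡ μ₂ j)
    × (∀ i j → 0ℚ < w i j → R i j)

IsStrongSim : (L₁ L₂ : RawLTS) → (Fin (size L₁) → Fin (size L₂) → Set) → Set
IsStrongSim L₁ L₂ R =
  ∀ s₁ s₂ → R s₁ s₂ → ∀ t₁ → t₁ ∈ trans L₁ → src t₁ ≡ s₁ →
    Σ (Trans (size L₂)) λ t₂ → t₂ ∈ trans L₂ × src t₂ ≡ s₂ × act t₂ ≡ act t₁
      × dist t₁ ⊑[ R ] dist t₂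

_≼_ : RawLTS → RawLTS → Set₁
L₁ ≼ L₂ = Σ (Fin (size L₁) → Fin (size L₂) → Set) λ R →
            IsStrongSim L₁ L₂ R × R (start L₁) (start L₂)

Consistent : List RawLTS → List RawLTS → RawLTS → Set₁
Consistent 𝒫 𝒩 L = All (λ P → P ≼ L) 𝒫 × All (λ N → ¬ (N ≼ L)) 𝒩

SP : List RawLTS → Set
SP 𝒫 = Σ (Fin (length 𝒫)) λ i → Fin (size (lookup 𝒫 i))

record Partition (𝒫 : List RawLTS) : Set where
  field
    classes   : ℕ
    cls       : SP 𝒫 → Fin classes
    surj      : ∀ e → ∃ λ x → cls x ≡ e
    rootClass : Fin classes
    roots     : ∀ i → cls (i , start (lookup 𝒫 i)) ≡ rootClass
open Partition public

quotient : (𝒫 : List RawLTS) → Partition 𝒫 → RawLTS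
quotient 𝒫 Π = mkRaw (classes Π) (rootClass Π)
  (concatMap (λ i → map (qt i) (trans (lookup 𝒫 i))) (allFin (length 𝒫)))
  where
  qt : (i : Fin (length 𝒫)) → Trans (size (lookup 𝒫 i)) → Trans (classes Π)
  qt i t = mkTrans (cls Π (i , src t)) (act t)
    (λ e → sumF (λ s → if does (cls Π (i , s) ≟ e) then dist t s else 0ℚ))

ConsistentPartition : (𝒫 𝒩 : List RawLTS) → Partition 𝒫 → Set₁
ConsistentPartition 𝒫 𝒩 Π = All (λ N → ¬ (N ≼ quotient 𝒫 Π)) 𝒩

-- Every strong simulation P ≼ L contains a decidable one, namely the least relation containing
-- the start states and closed under the supports of the weight functions the simulation
-- chooses; since nothing flows into the root of a tree, it may relate the root only to the
-- start state of L. Put two states of S_𝒫 in the same class iff these decidable simulations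
-- relate them to the same set of states of L. There are at most 2^k such sets, and all roots
-- share the set {start L}. Pushing the weight functions forward along the class map shows
-- 𝒫/Π ≼ L, relating a class to the members of its set; so N ≼ 𝒫/Π would give N ≼ L.
module Submission where

open import Defs

open import Algebra.Bundles using (CommutativeRing; CommutativeMonoid)
import Algebra.Properties.CommutativeSemigroup as CommutativeSemigroupProperties
import Algebra.Properties.Semiring.Sum as SemiringSum
open import Data.Bool using (Bool; true; false; if_then_else_; T)
import Data.Bool as 𝔹
open import Data.Bool.Properties using (_<?_)
open import Data.Empty using (⊥-elim)
open import Data.Fin using (Fin; zero; suc; _≟_; funToFin; finToFun; combine)
open import Data.Fin.Properties using (injective⇒≤; 2↔Bool; finToFun-funToFin) renaming (any? to anyFin?)
open import Data.List using (List; []; _∷_; length; lookup; allFin; cartesianProduct; map; concatMap; deduplicate)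
open import Data.List.Membership.Propositional using (_∈_; find; lose)
open import Data.List.Membership.Propositional.Properties
  using (∈-lookup; ∈-allFin; ∈-cartesianProduct⁺; ∈-map⁺; ∈-map⁻; ∈-concatMap⁺; ∈-concatMap⁻; ∈-deduplicate⁺; ∈-deduplicate⁻)
open import Data.List.Relation.Unary.All using (All)
import Data.List.Relation.Unary.All as All
open import Data.List.Relation.Unary.AllPairs using (_∷_)
open import Data.List.Relation.Unary.Any using (here; there; any?; index)
open import Data.List.Relation.Unary.Any.Properties using (lookup-index)
open import Data.List.Relation.Unary.Unique.Propositional using (Unique)
open import Data.List.Relation.Unary.Unique.DecPropositional.Properties using (deduplicate-!)
open import Data.Maybe using (Maybe; just; nothing; is-just; _<∣>_)
import Data.Maybe as Maybe
open import Data.Nat as ℕ using (ℕ; zero; suc; z≤n; s≤s; _^_)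
import Data.Nat.Properties as ℕ
open import Data.Product using (Σ; ∃; _×_; _,_; proj₁; proj₂)
open import Data.Rational using (ℚ; 0ℚ; 1ℚ; _+_; _*_; _≤_; _<_; 1/_; positive; nonNegative)
import Data.Rational as ℚ
open import Data.Rational.Properties
  using ( +-*-commutativeRing; *-1-commutativeMonoid
        ; ≤-refl; ≤-trans; ≤-antisym; <-irrefl; <⇒≤; <-≤-trans; ≮⇒≥
        ; +-mono-≤; +-monoʳ-≤; +-monoˡ-≤; +-identityʳ; +-identityˡ
        ; *-comm; *-zeroʳ; *-zeroˡ; *-identityʳ; *-inverseʳ
        ; *-monoˡ-≤-nonNeg; *-cancelˡ-<-nonNeg; *-cancelʳ-<-nonNeg
        ; pos⇒nonZero; 1/pos⇒pos; positive⁻¹ )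
open import Data.Unit using (tt)
open import Function using (_∘_; id; Inverse)
open import Relation.Binary.PropositionalEquality
  using (_≡_; _≢_; refl; sym; cong; cong₂; subst) renaming (trans to ≡-trans)
open import Relation.Binary.PropositionalEquality.Properties using (module ≡-Reasoning)
open import Relation.Nullary using (Dec; yes; no; does; ¬_; contradiction)
open import Relation.Nullary.Decidable using (dec⇒maybe)

open SemiringSum (CommutativeRing.semiring +-*-commutativeRing)
  using (sum; sum-cong-≗; ∑-comm; *-distribˡ-sum)
open CommutativeSemigroupProperties (CommutativeMonoid.commutativeSemigroup *-1-commutativeMonoid)
  using () renaming (x∙yz≈y∙xz to *-left-comm)

sumF≡sum : ∀ {n} (f : Fin n → ℚ) → sumF f ≡ sum f
sumF≡sum {zero}  f = refl
sumF≡sum {suc n} f = cong (f zero +_) (sumF≡sum (f ∘ suc))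

sumF-cong : ∀ {n} {f g : Fin n → ℚ} → (∀ i → f i ≡ g i) → sumF f ≡ sumF g
sumF-cong {zero}  f≗g = refl
sumF-cong {suc n} f≗g = cong₂ _+_ (f≗g zero) (sumF-cong (f≗g ∘ suc))

sumF-zero : ∀ n → sumF {n} (λ _ → 0ℚ) ≡ 0ℚ
sumF-zero zero    = refl
sumF-zero (suc n) = cong (0ℚ +_) (sumF-zero n)

sumF-comm : ∀ {m n} (f : Fin m → Fin n → ℚ) →
            sumF (λ i → sumF (f i)) ≡ sumF (λ j → sumF (λ i → f i j))
sumF-comm f = begin
  sumF (λ i → sumF (f i))          ≡⟨ sumF≡sum (λ i → sumF (f i)) ⟩
  sum (λ i → sumF (f i))           ≡⟨ sum-cong-≗ (sumF≡sum ∘ f) ⟩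
  sum (λ i → sum (f i))            ≡⟨ ∑-comm f ⟩
  sum (λ j → sum (λ i → f i j))    ≡⟨ sum-cong-≗ (λ j → sumF≡sum (λ i → f i j)) ⟨
  sum (λ j → sumF (λ i → f i j))   ≡⟨ sumF≡sum (λ j → sumF (λ i → f i j)) ⟨
  sumF (λ j → sumF (λ i → f i j))  ∎
  where open ≡-Reasoning

*-distribˡ-sumF : ∀ {n} x (f : Fin n → ℚ) → sumF (λ i → x * f i) ≡ x * sumF f
*-distribˡ-sumF x f = begin
  sumF (λ i → x * f i)  ≡⟨ sumF≡sum (λ i → x * f i) ⟩
  sum (λ i → x * f i)   ≡⟨ *-distribˡ-sum x f ⟨
  x * sum f             ≡⟨ cong (x *_) (sumF≡sum f) ⟨
  x * sumF f            ∎
  where open ≡-Reasoning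

*-distribʳ-sumF : ∀ {n} x (f : Fin n → ℚ) → sumF (λ i → f i * x) ≡ sumF f * x
*-distribʳ-sumF x f = begin
  sumF (λ i → f i * x)  ≡⟨ sumF-cong (λ i → *-comm (f i) x) ⟩
  sumF (λ i → x * f i)  ≡⟨ *-distribˡ-sumF x f ⟩
  x * sumF f            ≡⟨ *-comm x (sumF f) ⟩
  sumF f * x            ∎
  where open ≡-Reasoning

sumF-indicator : ∀ {n} (c : Fin n) a → sumF (λ e → if does (c ≟ e) then a else 0ℚ) ≡ a
sumF-indicator {suc n} zero    a = ≡-trans (cong (a +_) (sumF-zero n)) (+-identityʳ a)
sumF-indicator {suc n} (suc c) a = ≡-trans (+-identityˡ _) (sumF-indicator c a)

sumF-if : ∀ {n} b (f : Fin n → ℚ) → sumF (λ i → if b then f i else 0ℚ) ≡ (if b then sumF f else 0ℚ)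
sumF-if     true  f = refl
sumF-if {n} false f = sumF-zero n

sumF-nonneg : ∀ {n} {f : Fin n → ℚ} → (∀ i → 0ℚ ≤ f i) → 0ℚ ≤ sumF f
sumF-nonneg {zero}  f≥0 = ≤-refl
sumF-nonneg {suc n} f≥0 = +-mono-≤ (f≥0 zero) (sumF-nonneg (f≥0 ∘ suc))

term≤sumF : ∀ {n} {f : Fin n → ℚ} → (∀ i → 0ℚ ≤ f i) → ∀ i → f i ≤ sumF f
term≤sumF {f = f} f≥0 zero =
  subst (_≤ sumF f) (+-identityʳ (f zero)) (+-monoʳ-≤ (f zero) (sumF-nonneg (f≥0 ∘ suc)))
term≤sumF {f = f} f≥0 (suc i) =
  ≤-trans (term≤sumF (f≥0 ∘ suc) i)
          (subst (_≤ sumF f) (+-identityˡ _) (+-monoˡ-≤ (sumF (f ∘ suc)) (f≥0 zero)))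

sumF≡0⇒≡0 : ∀ {n} {f : Fin n → ℚ} → (∀ i → 0ℚ ≤ f i) → sumF f ≡ 0ℚ → ∀ i → f i ≡ 0ℚ
sumF≡0⇒≡0 f≥0 Σf≡0 i = ≤-antisym (subst (_ ≤_) Σf≡0 (term≤sumF f≥0 i)) (f≥0 i)

sumF-pos⇒pos : ∀ {n} (f : Fin n → ℚ) → 0ℚ < sumF f → ∃ λ i → 0ℚ < f i
sumF-pos⇒pos {zero}  f Σf>0 = contradiction Σf>0 (<-irrefl refl)
sumF-pos⇒pos {suc n} f Σf>0 with 0ℚ ℚ.<? f zero | 0ℚ ℚ.<? sumF (f ∘ suc)
... | yes f₀>0 | _         = zero , f₀>0
... | no  _    | yes Σ>0   = let i , fᵢ>0 = sumF-pos⇒pos (f ∘ suc) Σ>0 in suc i , fᵢ>0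
... | no  f₀≯0 | no  Σ≯0   = contradiction (<-≤-trans Σf>0 (+-mono-≤ (≮⇒≥ f₀≯0) (≮⇒≥ Σ≯0))) (<-irrefl refl)

*-nonneg : ∀ {a b} → 0ℚ ≤ a → 0ℚ ≤ b → 0ℚ ≤ a * b
*-nonneg {a} {b} a≥0 b≥0 = subst (_≤ a * b) (*-zeroʳ a) (*-monoˡ-≤-nonNeg a {{nonNegative a≥0}} b≥0)

*-pos⇒posˡ : ∀ {a b} → 0ℚ ≤ b → 0ℚ < a * b → 0ℚ < a
*-pos⇒posˡ {a} {b} b≥0 ab>0 = *-cancelʳ-<-nonNeg b {{nonNegative b≥0}} (subst (_< a * b) (sym (*-zeroˡ b)) ab>0)

*-pos⇒posʳ : ∀ {a b} → 0ℚ ≤ a → 0ℚ < a * b → 0ℚ < b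
*-pos⇒posʳ {a} {b} a≥0 ab>0 = *-cancelˡ-<-nonNeg a {{nonNegative a≥0}} (subst (_< a * b) (sym (*-zeroʳ a)) ab>0)

inv₀ : ℚ → ℚ
inv₀ y with 0ℚ ℚ.<? y
... | yes y>0 = (1/ y) {{pos⇒nonZero y {{positive y>0}}}}
... | no  _   = 0ℚ

inv₀-nonneg : ∀ y → 0ℚ ≤ inv₀ y
inv₀-nonneg y with 0ℚ ℚ.<? y
... | yes y>0 = <⇒≤ (positive⁻¹ _ {{1/pos⇒pos y {{positive y>0}}}})
... | no  _   = ≤-refl

*-inv₀-cancel : ∀ a {y} → 0ℚ ≤ y → (y ≡ 0ℚ → a ≡ 0ℚ) → a * (y * inv₀ y) ≡ a
*-inv₀-cancel a {y} y≥0 a≡0 with 0ℚ ℚ.<? y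
... | yes y>0 = ≡-trans (cong (a *_) (*-inverseʳ y {{pos⇒nonZero y {{positive y>0}}}})) (*-identityʳ a)
... | no  y≯0 = begin
  a * (y * 0ℚ)  ≡⟨ cong (a *_) (*-zeroʳ y) ⟩
  a * 0ℚ        ≡⟨ *-zeroʳ a ⟩
  0ℚ            ≡⟨ a≡0 (≤-antisym (≮⇒≥ y≯0) y≥0) ⟨
  a             ∎
  where open ≡-Reasoning

module _ {n₁ n₂} {μ : Fin n₁ → ℚ} {ν : Fin n₂ → ℚ} {R : Fin n₁ → Fin n₂ → Set} where

  ⊑-support : (μ⊑ν : μ ⊑[ R ] ν) → ∀ i j → 0ℚ < proj₁ μ⊑ν i j → R i j
  ⊑-support (_ , _ , _ , _ , supp) = supp

  ⊑-relax : ∀ {R′} (μ⊑ν : μ ⊑[ R ] ν) → (∀ i j → 0ℚ < proj₁ μ⊑ν i j → R′ i j) → μ ⊑[ R′ ] ν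
  ⊑-relax (w , bounds , rows , cols , _) supp = w , bounds , rows , cols , supp

  ⊑-weight⇒InSupp : (μ⊑ν : μ ⊑[ R ] ν) → ∀ i j → 0ℚ < proj₁ μ⊑ν i j → InSupp i μ
  ⊑-weight⇒InSupp (w , bounds , rows , _ , _) i j wᵢⱼ>0 =
    <-≤-trans wᵢⱼ>0 (subst (w i j ≤_) (rows i) (term≤sumF (λ j → proj₁ (bounds i j)) j))

IsDist⇒≤1 : ∀ {n} {μ : Fin n → ℚ} → IsDist μ → ∀ i → μ i ≤ 1ℚ
IsDist⇒≤1 {μ = μ} (μ≥0 , Σμ≡1) i = subst (μ i ≤_) Σμ≡1 (term≤sumF μ≥0 i)

-- Relation.Binary.Construct.Composition._;_ cannot be written, ; being a reserved symbol.
_⨾_ : ∀ {n₁ n₂ n₃} → (Fin n₁ → Fin n₂ → Set) → (Fin n₂ → Fin n₃ → Set) → Fin n₁ → Fin n₃ → Set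
(R₁ ⨾ R₂) i k = ∃ λ j → R₁ i j × R₂ j k

module _ {n₁ n₂ n₃} {μ₁ : Fin n₁ → ℚ} {μ₂ : Fin n₂ → ℚ} {μ₃ : Fin n₃ → ℚ}
         {R₁ : Fin n₁ → Fin n₂ → Set} {R₂ : Fin n₂ → Fin n₃ → Set} where

  -- The mass w₁ i j arriving at j is passed on to k in the proportion w₂ j k / μ₂ j.
  ⊑-trans : (∀ i → μ₁ i ≤ 1ℚ) → μ₁ ⊑[ R₁ ] μ₂ → μ₂ ⊑[ R₂ ] μ₃ → μ₁ ⊑[ R₁ ⨾ R₂ ] μ₃
  ⊑-trans μ₁≤1 (w₁ , bounds₁ , rows₁ , cols₁ , supp₁) (w₂ , bounds₂ , rows₂ , cols₂ , supp₂) =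
    w , bounds , rows , cols , supp
    where
    open ≡-Reasoning
    w₁≥0 : ∀ i j → 0ℚ ≤ w₁ i j
    w₁≥0 i j = proj₁ (bounds₁ i j)
    w₂≥0 : ∀ j k → 0ℚ ≤ w₂ j k
    w₂≥0 j k = proj₁ (bounds₂ j k)
    μ₂≥0 : ∀ j → 0ℚ ≤ μ₂ j
    μ₂≥0 j = subst (0ℚ ≤_) (rows₂ j) (sumF-nonneg (w₂≥0 j))
    r : Fin n₂ → Fin n₃ → ℚ
    r j k = w₂ j k * inv₀ (μ₂ j)
    r≥0 : ∀ j k → 0ℚ ≤ r j k
    r≥0 j k = *-nonneg (w₂≥0 j k) (inv₀-nonneg (μ₂ j))
    w : Fin n₁ → Fin n₃ → ℚ
    w i k = sumF (λ j → w₁ i j * r j k)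
    w≥0 : ∀ i k → 0ℚ ≤ w i k
    w≥0 i k = sumF-nonneg (λ j → *-nonneg (w₁≥0 i j) (r≥0 j k))

    rows : ∀ i → sumF (w i) ≡ μ₁ i
    rows i = begin
      sumF (λ k → sumF (λ j → w₁ i j * r j k))         ≡⟨ sumF-comm (λ j k → w₁ i j * r j k) ⟨
      sumF (λ j → sumF (λ k → w₁ i j * r j k))         ≡⟨ sumF-cong through ⟩
      sumF (w₁ i)                                      ≡⟨ rows₁ i ⟩
      μ₁ i                                             ∎
      where
      through : ∀ j → sumF (λ k → w₁ i j * r j k) ≡ w₁ i j
      through j = begin
        sumF (λ k → w₁ i j * r j k)              ≡⟨ *-distribˡ-sumF (w₁ i j) (r j) ⟩
        w₁ i j * sumF (r j)                      ≡⟨ cong (w₁ i j *_) (*-distribʳ-sumF (inv₀ (μ₂ j)) (w₂ j)) ⟩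
        w₁ i j * (sumF (w₂ j) * inv₀ (μ₂ j))     ≡⟨ cong (λ m → w₁ i j * (m * inv₀ (μ₂ j))) (rows₂ j) ⟩
        w₁ i j * (μ₂ j * inv₀ (μ₂ j))            ≡⟨ *-inv₀-cancel (w₁ i j) (μ₂≥0 j)
                                                     (λ μ₂ⱼ≡0 → sumF≡0⇒≡0 (λ i → w₁≥0 i j) (≡-trans (cols₁ j) μ₂ⱼ≡0) i) ⟩
        w₁ i j                                   ∎

    cols : ∀ k → sumF (λ i → w i k) ≡ μ₃ k
    cols k = begin
      sumF (λ i → sumF (λ j → w₁ i j * r j k))    ≡⟨ sumF-comm (λ i j → w₁ i j * r j k) ⟩
      sumF (λ j → sumF (λ i → w₁ i j * r j k))    ≡⟨ sumF-cong through ⟩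
      sumF (λ j → w₂ j k)                         ≡⟨ cols₂ k ⟩
      μ₃ k                                        ∎
      where
      through : ∀ j → sumF (λ i → w₁ i j * r j k) ≡ w₂ j k
      through j = begin
        sumF (λ i → w₁ i j * r j k)              ≡⟨ *-distribʳ-sumF (r j k) (λ i → w₁ i j) ⟩
        sumF (λ i → w₁ i j) * r j k              ≡⟨ cong (_* r j k) (cols₁ j) ⟩
        μ₂ j * (w₂ j k * inv₀ (μ₂ j))            ≡⟨ *-left-comm (μ₂ j) (w₂ j k) (inv₀ (μ₂ j)) ⟩
        w₂ j k * (μ₂ j * inv₀ (μ₂ j))            ≡⟨ *-inv₀-cancel (w₂ j k) (μ₂≥0 j)
                                                     (λ μ₂ⱼ≡0 → sumF≡0⇒≡0 (w₂≥0 j) (≡-trans (rows₂ j) μ₂ⱼ≡0) k) ⟩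
        w₂ j k                                   ∎

    bounds : ∀ i k → 0ℚ ≤ w i k × w i k ≤ 1ℚ
    bounds i k = w≥0 i k , ≤-trans (subst (w i k ≤_) (rows i) (term≤sumF (w≥0 i) k)) (μ₁≤1 i)

    supp : ∀ i k → 0ℚ < w i k → (R₁ ⨾ R₂) i k
    supp i k wᵢₖ>0 =
      let j , term>0 = sumF-pos⇒pos (λ j → w₁ i j * r j k) wᵢₖ>0
      in  j , supp₁ i j (*-pos⇒posˡ (r≥0 j k) term>0)
            , supp₂ j k (*-pos⇒posˡ (inv₀-nonneg (μ₂ j)) (*-pos⇒posʳ (w₁≥0 i j) term>0))

pushforward : ∀ {n c} → (Fin n → Fin c) → (Fin n → ℚ) → Fin c → ℚ
pushforward cl μ e = sumF (λ s → if does (cl s ≟ e) then μ s else 0ℚ)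

if-nonneg : ∀ b {a} → 0ℚ ≤ a → 0ℚ ≤ (if b then a else 0ℚ)
if-nonneg true  a≥0 = a≥0
if-nonneg false _   = ≤-refl

module _ {n m c} {μ : Fin n → ℚ} {ν : Fin m → ℚ} {R : Fin c → Fin m → Set} (cl : Fin n → Fin c) where

  pushforward-⊑ : (∀ j → ν j ≤ 1ℚ) → μ ⊑[ (λ s j → R (cl s) j) ] ν → pushforward cl μ ⊑[ R ] ν
  pushforward-⊑ ν≤1 (w , bounds , rows , cols , supp) = w′ , bounds′ , rows′ , cols′ , supp′
    where
    open ≡-Reasoning
    w′ : Fin c → Fin m → ℚ
    w′ e j = pushforward cl (λ s → w s j) e
    w′≥0 : ∀ e j → 0ℚ ≤ w′ e j
    w′≥0 e j = sumF-nonneg (λ s → if-nonneg (does (cl s ≟ e)) (proj₁ (bounds s j)))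

    _∈?_▹_ : Fin n → Fin c → ℚ → ℚ
    s ∈? e ▹ x = if does (cl s ≟ e) then x else 0ℚ

    rows′ : ∀ e → sumF (w′ e) ≡ pushforward cl μ e
    rows′ e = begin
      sumF (λ j → sumF (λ s → s ∈? e ▹ w s j))  ≡⟨ sumF-comm (λ s j → s ∈? e ▹ w s j) ⟨
      sumF (λ s → sumF (λ j → s ∈? e ▹ w s j))  ≡⟨ sumF-cong (λ s → sumF-if (does (cl s ≟ e)) (w s)) ⟩
      sumF (λ s → s ∈? e ▹ sumF (w s))          ≡⟨ sumF-cong (λ s → cong (s ∈? e ▹_) (rows s)) ⟩
      pushforward cl μ e                        ∎

    cols′ : ∀ j → sumF (λ e → w′ e j) ≡ ν j
    cols′ j = begin
      sumF (λ e → sumF (λ s → s ∈? e ▹ w s j))  ≡⟨ sumF-comm (λ e s → s ∈? e ▹ w s j) ⟩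
      sumF (λ s → sumF (λ e → s ∈? e ▹ w s j))  ≡⟨ sumF-cong (λ s → sumF-indicator (cl s) (w s j)) ⟩
      sumF (λ s → w s j)                        ≡⟨ cols j ⟩
      ν j                                       ∎

    bounds′ : ∀ e j → 0ℚ ≤ w′ e j × w′ e j ≤ 1ℚ
    bounds′ e j = w′≥0 e j , ≤-trans (subst (w′ e j ≤_) (cols′ j) (term≤sumF (λ e → w′≥0 e j) e)) (ν≤1 j)

    supp′ : ∀ e j → 0ℚ < w′ e j → R e j
    supp′ e j w′ₑⱼ>0 with sumF-pos⇒pos _ w′ₑⱼ>0
    ... | s , term>0 with cl s ≟ e
    ...   | yes refl = supp s j term>0
    ...   | no  _    = contradiction term>0 (<-irrefl refl)

module _ {L₁ L₂ L₃ : RawLTS} where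

  ⨾-isStrongSim : ∀ {R₁ R₂} → IsLPTS L₁ → IsStrongSim L₁ L₂ R₁ → IsStrongSim L₂ L₃ R₂ →
                  IsStrongSim L₁ L₃ (R₁ ⨾ R₂)
  ⨾-isStrongSim lts₁ sim₁ sim₂ s₁ s₃ (s₂ , r₁ , r₂) t₁ t₁∈ src₁ =
    let t₂ , t₂∈ , src₂ , act₂ , μ₁⊑μ₂ = sim₁ s₁ s₂ r₁ t₁ t₁∈ src₁
        t₃ , t₃∈ , src₃ , act₃ , μ₂⊑μ₃ = sim₂ s₂ s₃ r₂ t₂ t₂∈ src₂
    in  t₃ , t₃∈ , src₃ , ≡-trans act₃ act₂ , ⊑-trans (IsDist⇒≤1 (All.lookup lts₁ t₁∈)) μ₁⊑μ₂ μ₂⊑μ₃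

  ≼-trans : IsLPTS L₁ → L₁ ≼ L₂ → L₂ ≼ L₃ → L₁ ≼ L₃
  ≼-trans lts₁ (R₁ , sim₁ , r₁) (R₂ , sim₂ , r₂) =
    R₁ ⨾ R₂ , ⨾-isStrongSim lts₁ sim₁ sim₂ , (start L₂ , r₁ , r₂)

RootIsolated : RawLTS → Set
RootIsolated P = ∀ {t} → t ∈ trans P → ¬ InSupp (start P) (dist t)

tree⇒rootIsolated : ∀ {P} → IsTree P → RootIsolated P
tree⇒rootIsolated (root∉supp , _) t∈ =
  subst (λ t → ¬ InSupp _ (dist t)) (sym (lookup-index t∈)) (root∉supp (index t∈))

module _ {P L : RawLTS} where

  RootToStart : Fin (size P) → Fin (size L) → Set
  RootToStart s l = s ≡ start P → l ≡ start L

  rootToStart-isStrongSim : ∀ {R} → RootIsolated P → IsStrongSim P L R →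
                            IsStrongSim P L (λ s l → RootToStart s l × R s l)
  rootToStart-isStrongSim isolated sim s l (_ , r) t t∈ srcₜ =
    let t₂ , t₂∈ , src₂ , act₂ , μ⊑ν = sim s l r t t∈ srcₜ
    in  t₂ , t₂∈ , src₂ , act₂ , ⊑-relax μ⊑ν (λ s′ l′ w>0 →
          (λ { refl → contradiction (⊑-weight⇒InSupp μ⊑ν s′ l′ w>0) (isolated t∈) }) ,
          ⊑-support μ⊑ν s′ l′ w>0)

module _ {A : Set} where

  count : (A → Bool) → List A → ℕ
  count p []       = 0
  count p (x ∷ xs) = if p x then suc (count p xs) else count p xs

  count≤length : ∀ p xs → count p xs ℕ.≤ length xs
  count≤length p []       = z≤n
  count≤length p (x ∷ xs) with p x
  ... | true  = s≤s (count≤length p xs)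
  ... | false = ℕ.m≤n⇒m≤1+n (count≤length p xs)

  module _ {p q : A → Bool} (p≤q : ∀ a → p a 𝔹.≤ q a) where

    count-mono : ∀ xs → count p xs ℕ.≤ count q xs
    count-mono []       = z≤n
    count-mono (x ∷ xs) with p x | q x | p≤q x
    ... | false | .true | 𝔹.f≤t = ℕ.m≤n⇒m≤1+n (count-mono xs)
    ... | false | .false | 𝔹.b≤b = count-mono xs
    ... | true  | .true  | 𝔹.b≤b = s≤s (count-mono xs)

    count-mono-< : ∀ {a xs} → a ∈ xs → p a 𝔹.< q a → count p xs ℕ.< count q xs
    count-mono-< {xs = x ∷ xs} (here refl) pa<qa with p x | q x | pa<qa
    ... | .false | .true | 𝔹.f<t = s≤s (count-mono xs)
    count-mono-< {xs = x ∷ xs} (there a∈) pa<qa with p x | q x | p≤q x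
    ... | false | .true  | 𝔹.f≤t = ℕ.m≤n⇒m≤1+n (count-mono-< a∈ pa<qa)
    ... | false | .false | 𝔹.b≤b = count-mono-< a∈ pa<qa
    ... | true  | .true  | 𝔹.b≤b = s≤s (count-mono-< a∈ pa<qa)

≤∧≮⇒≡ : ∀ {a b} → a 𝔹.≤ b → ¬ a 𝔹.< b → b ≡ a
≤∧≮⇒≡ 𝔹.b≤b _   = refl
≤∧≮⇒≡ 𝔹.f≤t a≮b = contradiction 𝔹.f<t a≮b

-- Each strict increase adds an element of xs; the fuel bounds how many are still missing.
stabilises : ∀ {A : Set} (xs : List A) → (∀ a → a ∈ xs) →
             (f : ℕ → A → Bool) → (∀ n a → f n a 𝔹.≤ f (suc n) a) →
             ∃ λ N → ∀ a → f (suc N) a ≡ f N a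
stabilises xs complete f mono = go (length xs) 0 (ℕ.m≤m+n (length xs) _)
  where
  go : ∀ fuel n → length xs ℕ.≤ fuel ℕ.+ count (f n) xs → ∃ λ N → ∀ a → f (suc N) a ≡ f N a
  go fuel n bound with any? (λ a → f n a <? f (suc n) a) xs
  ... | no  noIncrease = n , λ a → ≤∧≮⇒≡ (mono n a) (noIncrease ∘ lose (complete a))
  ... | yes increase with find increase
  ...   | a , a∈ , fa<  with fuel
  ...     | zero     =
    ⊥-elim (ℕ.<⇒≱ (ℕ.≤-<-trans bound (count-mono-< (mono n) a∈ fa<)) (count≤length (f (suc n)) xs))
  ...     | suc fuel = go fuel (suc n) (begin
      length xs                         ≤⟨ bound ⟩
      suc fuel ℕ.+ count (f n) xs       ≡⟨ ℕ.+-suc fuel _ ⟨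
      fuel ℕ.+ suc (count (f n) xs)     ≤⟨ ℕ.+-monoʳ-≤ fuel (count-mono-< (mono n) a∈ fa<) ⟩
      fuel ℕ.+ count (f (suc n)) xs     ∎)
    where open ℕ.≤-Reasoning

T-mono : ∀ {a b} → a 𝔹.≤ b → T a → T b
T-mono 𝔹.b≤b t = t
T-mono 𝔹.f≤t _ = tt

just-witness : ∀ {A : Set} (m : Maybe A) → T (is-just m) → ∃ λ a → m ≡ just a
just-witness (just a) _ = a , refl

is-just-<∣>ˡ : ∀ {A : Set} (m m′ : Maybe A) → is-just m 𝔹.≤ is-just (m <∣> m′)
is-just-<∣>ˡ (just _) _        = 𝔹.b≤b
is-just-<∣>ˡ nothing  (just _) = 𝔹.f≤t
is-just-<∣>ˡ nothing  nothing  = 𝔹.b≤b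

is-just-<∣>ʳ : ∀ {A : Set} (m : Maybe A) {m′} → T (is-just m′) → T (is-just (m <∣> m′))
is-just-<∣>ʳ (just _) _ = tt
is-just-<∣>ʳ nothing  t = t

-- The stages store R-proofs of their members, because the weight functions chosen by R, and
-- hence the edges of the closure, depend on those proofs.
module DecidableCore {P L : RawLTS} {R : Fin (size P) → Fin (size L) → Set}
                     (sim : IsStrongSim P L R) (startᴿ : R (start P) (start L)) where

  private
    Tr : Fin (length (trans P)) → Trans (size P)
    Tr j = lookup (trans P) j

    match : ∀ j l → R (src (Tr j)) l →
            Σ (Trans (size L)) λ t₂ → t₂ ∈ trans L × src t₂ ≡ l × act t₂ ≡ act (Tr j) × dist (Tr j) ⊑[ R ] dist t₂
    match j l r = sim (src (Tr j)) l r (Tr j) (∈-lookup j) refl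

    weight-⊑ : ∀ j l (r : R (src (Tr j)) l) → dist (Tr j) ⊑[ R ] dist (proj₁ (match j l r))
    weight-⊑ j l r = proj₂ (proj₂ (proj₂ (proj₂ (match j l r))))

    weight : ∀ j l → R (src (Tr j)) l → Fin (size P) → Fin (size L) → ℚ
    weight j l r = proj₁ (weight-⊑ j l r)

  Approximation : Set
  Approximation = ∀ s l → Maybe (R s l)

  Step : Approximation → Fin (size P) → Fin (size L) → Set
  Step D s′ l′ = ∃ λ j → ∃ λ l → ∃ λ (r : R (src (Tr j)) l) → D (src (Tr j)) l ≡ just r × 0ℚ < weight j l r s′ l′

  step? : ∀ D s′ l′ → Dec (Step D s′ l′)
  step? D s′ l′ = anyFin? λ j → anyFin? λ l → edge? j l
    where
    edge? : ∀ j l → Dec (∃ λ r → D (src (Tr j)) l ≡ just r × 0ℚ < weight j l r s′ l′)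
    edge? j l with D (src (Tr j)) l
    ... | nothing = no λ { (_ , () , _) }
    ... | just r with 0ℚ ℚ.<? weight j l r s′ l′
    ...   | yes w>0 = yes (r , refl , w>0)
    ...   | no  w≯0 = no λ { (_ , refl , w>0) → w≯0 w>0 }

  step-sound : ∀ D {s′ l′} → Step D s′ l′ → R s′ l′
  step-sound D {s′} {l′} (j , l , r , _ , w>0) = ⊑-support (weight-⊑ j l r) s′ l′ w>0

  initial : Approximation
  initial s l with s ≟ start P | l ≟ start L
  ... | yes refl | yes refl = just startᴿ
  ... | _        | _        = nothing

  approx : ℕ → Approximation
  approx zero    s l = initial s l
  approx (suc n) s l = approx n s l <∣> Maybe.map (step-sound (approx n)) (dec⇒maybe (step? (approx n) s l))

  reached : ℕ → Fin (size P) × Fin (size L) → Bool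
  reached n (s , l) = is-just (approx n s l)

  -- Opaque, so that the typechecker never runs the iteration.
  private opaque
    stable : ∃ λ N → ∀ sl → reached (suc N) sl ≡ reached N sl
    stable = stabilises (cartesianProduct (allFin _) (allFin _))
                        (λ (s , l) → ∈-cartesianProduct⁺ (∈-allFin s) (∈-allFin l))
                        reached (λ n (s , l) → is-just-<∣>ˡ (approx n s l) _)

  private
    N : ℕ
    N = proj₁ stable

  core : Fin (size P) → Fin (size L) → Bool
  core s l = reached N (s , l)

  core-sound : ∀ {s l} → T (core s l) → R s l
  core-sound {s} {l} ρ = proj₁ (just-witness (approx N s l) ρ)

  core-start : T (core (start P) (start L))
  core-start = reached-start N
    where
    reached-start : ∀ n → T (reached n (start P , start L))
    reached-start zero with start P ≟ start P | start L ≟ start L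
    ... | yes refl | yes refl = tt
    ... | no  s≢s  | _        = contradiction refl s≢s
    ... | yes _    | no  l≢l  = contradiction refl l≢l
    reached-start (suc n) = T-mono (is-just-<∣>ˡ (approx n (start P) (start L)) _) (reached-start n)

  private
    core-closed : ∀ j l r → approx N (src (Tr j)) l ≡ just r →
                  ∀ s′ l′ → 0ℚ < weight j l r s′ l′ → T (core s′ l′)
    core-closed j l r approx≡r s′ l′ w>0 =
      subst T (proj₂ stable (s′ , l′)) (is-just-<∣>ʳ (approx N s′ l′) stepped)
      where
      stepped : T (is-just (Maybe.map (step-sound (approx N)) (dec⇒maybe (step? (approx N) s′ l′))))
      stepped with step? (approx N) s′ l′
      ... | yes _     = tt
      ... | no  ¬step = contradiction (j , l , r , approx≡r , w>0) ¬step

  core-isStrongSim : IsStrongSim P L (λ s l → T (core s l))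
  core-isStrongSim .(src t) l ρ t t∈ refl with index t∈ | lookup-index t∈
  ... | j | refl with just-witness (approx N (src (Tr j)) l) ρ
  ...   | r , approx≡r =
    let t₂ , t₂∈ , src₂ , act₂ , μ⊑ν = match j l r
    in  t₂ , t₂∈ , src₂ , act₂ , ⊑-relax μ⊑ν (core-closed j l r approx≡r)

unique⇒lookup-injective : ∀ {A : Set} {xs : List A} → Unique xs → ∀ {i j} → lookup xs i ≡ lookup xs j → i ≡ j
unique⇒lookup-injective {xs = _ ∷ _} (_ ∷ _)  {zero}  {zero}  _  = refl
unique⇒lookup-injective {xs = _ ∷ _} (x∉ ∷ _) {zero}  {suc j} eq = contradiction eq (All.lookup x∉ (∈-lookup j))
unique⇒lookup-injective {xs = _ ∷ _} (x∉ ∷ _) {suc i} {zero}  eq = contradiction (sym eq) (All.lookup x∉ (∈-lookup i))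
unique⇒lookup-injective {xs = _ ∷ _} (_ ∷ u)  {suc i} {suc j} eq = cong suc (unique⇒lookup-injective u eq)

module Image {X : Set} {M : ℕ} (xs : List X) (complete : ∀ x → x ∈ xs) (f : X → Fin M) where
  -- Opaque, so that conversion checking never tries to evaluate the deduplication.
  opaque

    image : List (Fin M)
    image = deduplicate _≟_ (map f xs)

    ∈-image : ∀ x → f x ∈ image
    ∈-image x = ∈-deduplicate⁺ _≟_ (∈-map⁺ f (complete x))

    rank : X → Fin (length image)
    rank x = index (∈-image x)

    lookup-rank : ∀ x → lookup image (rank x) ≡ f x
    lookup-rank x = sym (lookup-index (∈-image x))

    lookup-injective : ∀ {e e′} → lookup image e ≡ lookup image e′ → e ≡ e′
    lookup-injective = unique⇒lookup-injective (deduplicate-! _≟_ (map f xs))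

    rank-cong : ∀ {x y} → f x ≡ f y → rank x ≡ rank y
    rank-cong {x} {y} fx≡fy = lookup-injective (≡-trans (lookup-rank x) (≡-trans fx≡fy (sym (lookup-rank y))))

    rank-surjective : ∀ e → ∃ λ x → rank x ≡ e
    rank-surjective e =
      let x , _ , e↦fx = ∈-map⁻ f (∈-deduplicate⁻ _≟_ (map f xs) (∈-lookup e))
      in  x , lookup-injective (≡-trans (lookup-rank x) (sym e↦fx))

    length-image≤ : length image ℕ.≤ M
    length-image≤ = injective⇒≤ lookup-injective

funToFin-cong : ∀ {m n} {f g : Fin m → Fin n} → (∀ i → f i ≡ g i) → funToFin f ≡ funToFin g
funToFin-cong {zero}  _   = refl
funToFin-cong {suc m} f≗g = cong₂ combine (f≗g zero) (funToFin-cong (f≗g ∘ suc))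

T-ext : ∀ {a b} → (T a → T b) → (T b → T a) → a ≡ b
T-ext {false} {false} _ _ = refl
T-ext {true}  {true}  _ _ = refl
T-ext {true}  {false} a⇒b _ = ⊥-elim (a⇒b tt)
T-ext {false} {true}  _ b⇒a = ⊥-elim (b⇒a tt)

module _ (𝒫 : List RawLTS) where

  private
    statesOf : (i : Fin (length 𝒫)) → List (SP 𝒫)
    statesOf i = map (i ,_) (allFin _)

  enumerateSP : List (SP 𝒫)
  enumerateSP = concatMap statesOf (allFin _)

  ∈-enumerateSP : (x : SP 𝒫) → x ∈ enumerateSP
  ∈-enumerateSP (i , s) = ∈-concatMap⁺ statesOf (lose (∈-allFin i) (∈-map⁺ (i ,_) (∈-allFin s)))

module InducedPartition (𝒫 : List RawLTS) (L : RawLTS) (lts : IsLPTS L)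
                        (P≼L : ∀ i → lookup 𝒫 i ≼ L) (trees : ∀ i → IsTree (lookup 𝒫 i))
                        (i₀ : Fin (length 𝒫)) where

  private
    P : Fin (length 𝒫) → RawLTS
    P i = lookup 𝒫 i

  module Core (i : Fin (length 𝒫)) = DecidableCore
    (rootToStart-isStrongSim (tree⇒rootIsolated (trees i)) (proj₁ (proj₂ (P≼L i))))
    ((λ _ → refl) , proj₂ (proj₂ (P≼L i)))

  profile : SP 𝒫 → Fin (size L) → Bool
  profile (i , s) = Core.core i s

  roots-profile : ∀ i j l → profile (i , start (P i)) l ≡ profile (j , start (P j)) l
  roots-profile i j l = T-ext (to-start i j) (to-start j i)
    where
    to-start : ∀ i j → T (profile (i , start (P i)) l) → T (profile (j , start (P j)) l)
    to-start i j ρ = subst (λ l → T (profile (j , start (P j)) l))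
                           (sym (proj₁ (Core.core-sound i ρ) refl)) (Core.core-start j)

  open Inverse 2↔Bool using () renaming (from to bit; to to unbit; strictlyInverseˡ to unbit∘bit)

  code : SP 𝒫 → Fin (2 ^ size L)
  code x = funToFin (bit ∘ profile x)

  open Image (enumerateSP 𝒫) (∈-enumerateSP 𝒫) code public

  Π : Partition 𝒫
  Π = record
    { classes   = length image
    ; cls       = rank
    ; surj      = rank-surjective
    ; rootClass = rank (i₀ , start (P i₀))
    ; roots     = λ i → rank-cong (funToFin-cong (cong bit ∘ roots-profile i i₀))
    }

  InProfile : Fin (length image) → Fin (size L) → Set
  InProfile e l = T (unbit (finToFun (lookup image e) l))

  inProfile-rank : ∀ x l → InProfile (rank x) l ≡ T (profile x l)
  inProfile-rank x l = cong T (begin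
    unbit (finToFun (lookup image (rank x)) l)  ≡⟨ cong (λ c → unbit (finToFun c l)) (lookup-rank x) ⟩
    unbit (finToFun (code x) l)                 ≡⟨ cong unbit (finToFun-funToFin _ l) ⟩
    unbit (bit (profile x l))                   ≡⟨ unbit∘bit (profile x l) ⟩
    profile x l                                 ∎)
    where open ≡-Reasoning

  private
    liftTrans : (i : Fin (length 𝒫)) → Trans (size (P i)) → Trans (length image)
    liftTrans i t = mkTrans (rank (i , src t)) (act t) (pushforward (λ s → rank (i , s)) (dist t))

  quotient-isStrongSim : IsStrongSim (quotient 𝒫 Π) L InProfile
  quotient-isStrongSim e l ρ t₁ t₁∈ src₁
    with find (∈-concatMap⁻ (λ i → map (liftTrans i) (trans (P i))) {xs = allFin _} t₁∈)
  ... | i , _ , t₁∈ᵢ with ∈-map⁻ (liftTrans i) t₁∈ᵢ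
  ... | t , t∈ , refl with src₁
  ... | refl =
    let t₂ , t₂∈ , src₂ , act₂ , μ⊑ν =
          Core.core-isStrongSim i (src t) l (subst id (inProfile-rank (i , src t) l) ρ) t t∈ refl
    in  t₂ , t₂∈ , src₂ , act₂ ,
        pushforward-⊑ (λ s → rank (i , s)) (IsDist⇒≤1 (All.lookup lts t₂∈))
          (⊑-relax μ⊑ν λ s l′ w>0 → subst id (sym (inProfile-rank (i , s) l′)) (⊑-support μ⊑ν s l′ w>0))

  quotient≼L : quotient 𝒫 Π ≼ L
  quotient≼L = InProfile , quotient-isStrongSim ,
    subst id (sym (inProfile-rank (i₀ , start (P i₀)) (start L))) (Core.core-start i₀)

  consistent : ∀ {𝒩} → All IsLPTS 𝒩 → All (λ N → ¬ N ≼ L) 𝒩 → ConsistentPartition 𝒫 𝒩 Π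
  consistent 𝒩-lts 𝒩⋠L = All.zipWith (λ (ltsᴺ , N⋠L) N≼Q → N⋠L (≼-trans ltsᴺ N≼Q quotient≼L)) (𝒩-lts , 𝒩⋠L)

corollary1 : (𝒫 𝒩 : List RawLTS) → 𝒫 ≢ []
    → All (λ P → IsLPTS P × IsTree P) 𝒫
    → All (λ N → IsLPTS N × IsTree N) 𝒩
    → (L : RawLTS) → IsLPTS L → Consistent 𝒫 𝒩 L
    → Σ (Partition 𝒫) λ Π → classes Π ℕ.≤ 2 ^ size L × ConsistentPartition 𝒫 𝒩 Π
corollary1 []          _ 𝒫≢[] _ _ _ _ _ = contradiction refl 𝒫≢[]
corollary1 𝒫@(_ ∷ _) 𝒩 _ 𝒫-trees 𝒩-trees L lts (𝒫≼L , 𝒩⋠L) =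
  Π , length-image≤ , consistent (All.map proj₁ 𝒩-trees) 𝒩⋠L
  where
  open InducedPartition 𝒫 L lts (λ i → All.lookup 𝒫≼L (∈-lookup i))
                                (λ i → proj₂ (All.lookup 𝒫-trees (∈-lookup i))) zero
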